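{- Let $T\in\mathbb{T}$. Then no non-pendant edge of $T$ belongs to a maximum matching of $T$.
   Context: $\mathbb{T}$ is the class of simple undirected weighted trees (nonzero real edge weights) $T$ such that (i) $T$ has at least one non-pendant vertex, and (ii) every non-pendant vertex of $T$ is adjacent to at least one pendant vertex. A pendant vertex is a vertex of degree one; a pendant edge is an edge incident to a pendant vertex, and a non-pendant edge is any other edge. A maximum matching is a set of pairwise vertex-disjoint edges of maximum cardinality. -}

module Defs where

open import Data.Nat using (ℕ; _≤_)
open import Data.Fin using (Fin)
open import Data.Bool using (Bool; true; false)
open import Data.List using (List; []; _∷_; length; filterᵇ; allFin; concatMap; _∷ʳ_)
open import Data.List.Membership.Propositional using (_∈_)
open import Data.List.Relation.Unary.All using (All)
open import Data.List.Relation.Unary.Unique.Propositional using (Unique)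
open import Data.Product using (_×_; _,_; ∃; Σ)
open import Data.Sum using (_⊎_)
open import Relation.Binary.PropositionalEquality using (_≡_)
open import Relation.Nullary using (¬_)

record SimpleGraph (n : ℕ) : Set where
  field
    adj    : Fin n → Fin n → Bool
    sym    : ∀ u v → adj u v ≡ adj v u
    irrefl : ∀ v → adj v v ≡ false

module _ {n : ℕ} (G : SimpleGraph n) where
  open SimpleGraph G

  E : Fin n → Fin n → Set
  E u v = adj u v ≡ true

  degree : Fin n → ℕ
  degree v = length (filterᵇ (adj v) (allFin n))

  Pendant : Fin n → Set
  Pendant v = degree v ≡ 1

  data Walk : Fin n → Fin n → Set where
    here : ∀ {v} → Walk v v
    step : ∀ {u w v} → E u w → Walk w v → Walk u v

  Connected : Set
  Connected = ∀ u v → Walk u v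

  data Chain : List (Fin n) → Set where
    nil  : Chain []
    one  : ∀ {x} → Chain (x ∷ [])
    cons : ∀ {x y xs} → E x y → Chain (y ∷ xs) → Chain (x ∷ y ∷ xs)

  IsCycle : Fin n → List (Fin n) → Set
  IsCycle x ys = (2 ≤ length ys) × Unique (x ∷ ys) × Chain ((x ∷ ys) ∷ʳ x)

  Acyclic : Set
  Acyclic = ∀ x ys → ¬ IsCycle x ys

  IsTree : Set
  IsTree = Connected × Acyclic

  endpoints : List (Fin n × Fin n) → List (Fin n)
  endpoints = concatMap (λ { (u , v) → u ∷ v ∷ [] })

  IsMatching : List (Fin n × Fin n) → Set
  IsMatching M = All (λ { (u , v) → E u v }) M × Unique (endpoints M)

  IsMaximumMatching : List (Fin n × Fin n) → Set
  IsMaximumMatching M = IsMatching M × (∀ M′ → IsMatching M′ → length M′ ≤ length M)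

  InMatching : Fin n → Fin n → List (Fin n × Fin n) → Set
  InMatching u v M = ((u , v) ∈ M) ⊎ ((v , u) ∈ M)

  NonPendantEdge : Fin n → Fin n → Set
  NonPendantEdge u v = E u v × ¬ Pendant u × ¬ Pendant v

  -- membership in the class 𝕋 (weights play no role)
  InClassT : Set
  InClassT = IsTree
           × (∃ λ v → ¬ Pendant v)
           × (∀ v → ¬ Pendant v → ∃ λ u → E v u × Pendant u)

-- If a non-pendant edge uv lay in a maximum matching M, let a and b be pendant
-- neighbours of u and v. Their only neighbours are u and v, which M − uv leaves
-- uncovered, so a and b are uncovered by M − uv as well; then M − uv + au + bv is
-- a matching with one edge more than M.
module Submission where

open import Defs
open import Data.Nat using (ℕ; suc; _≤_)
open import Data.Nat.Properties using (1+n≰n)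
open import Data.Fin using (Fin)
open import Data.Bool using (T?)
open import Data.Bool.Properties using (T-≡)
open import Data.Product using (_×_; _,_; ∃)
open import Data.Sum using (inj₁; inj₂)
open import Data.List using (List; []; _∷_; _++_; [_]; length; filterᵇ; allFin)
open import Data.List.Membership.Propositional using (_∈_; _∉_)
open import Data.List.Membership.Propositional.Properties using (∈-∃++; ∈-allFin; ∈-filter⁺)
open import Data.List.Relation.Unary.Any using (here; there)
open import Data.List.Relation.Unary.All using (All; _∷_)
open import Data.List.Relation.Unary.All.Properties using (¬Any⇒All¬)
open import Data.List.Relation.Unary.AllPairs using (_∷_)
open import Data.List.Relation.Unary.Unique.Propositional using (Unique)
open import Data.List.Relation.Unary.Unique.Propositional.Properties using (Unique[x∷xs]⇒x∉xs)
open import Data.List.Relation.Binary.Permutation.Propositional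
  using (_↭_; refl; prep; swap; trans; ↭⇒↭ₛ)
open import Data.List.Relation.Binary.Permutation.Propositional.Properties
  using (All-resp-↭; ↭-length; ++⁺ˡ; shift; shifts)
import Data.List.Relation.Binary.Permutation.Setoid.Properties as SetoidPerm
open import Function.Bundles using (Equivalence)
open import Relation.Binary.PropositionalEquality using (_≡_; _≢_; refl; subst; setoid)
import Relation.Binary.PropositionalEquality as ≡
open import Relation.Nullary using (¬_)

module _ {A : Set} where

  Unique-resp-↭ : {xs ys : List A} → xs ↭ ys → Unique xs → Unique ys
  Unique-resp-↭ p = SetoidPerm.Unique-resp-↭ (setoid A) (↭⇒↭ₛ p)

  Unique-∷ : {x : A} {xs : List A} → x ∉ xs → Unique xs → Unique (x ∷ xs)
  Unique-∷ x∉xs xs! = ¬Any⇒All¬ _ x∉xs ∷ xs!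

  ∉-∷ : {x y : A} {xs : List A} → x ≢ y → x ∉ xs → x ∉ y ∷ xs
  ∉-∷ x≢y x∉xs (here x≡y) = x≢y x≡y
  ∉-∷ x≢y x∉xs (there x∈xs) = x∉xs x∈xs

  ∈-length≡1⇒≡ : {x y : A} {xs : List A} → length xs ≡ 1 → x ∈ xs → y ∈ xs → x ≡ y
  ∈-length≡1⇒≡ {xs = _ ∷ []} _ (here refl) (here refl) = refl

module _ {n : ℕ} (G : SimpleGraph n) where
  open SimpleGraph G using (adj; irrefl)

  AllEdges : List (Fin n × Fin n) → Set
  AllEdges M = All (λ { (u , v) → E G u v }) M

  E-sym : ∀ {u v} → E G u v → E G v u
  E-sym {u} {v} u~v = ≡.trans (SimpleGraph.sym G v u) u~v

  E-irrefl : ∀ {u v} → E G u v → u ≢ v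
  E-irrefl {u} u~u refl with ≡.trans (≡.sym (irrefl u)) u~u
  ... | ()

  neighbour-of-pendant-unique : ∀ {p x y} → Pendant G p → E G p x → E G p y → x ≡ y
  neighbour-of-pendant-unique {p} p-pendant p~x p~y =
    ∈-length≡1⇒≡ p-pendant (∈-neighbours p~x) (∈-neighbours p~y)
    where
    ∈-neighbours : ∀ {z} → E G p z → z ∈ filterᵇ (adj p) (allFin n)
    ∈-neighbours {z} p~z =
      ∈-filter⁺ (λ w → T? (adj p w)) (∈-allFin z) (Equivalence.from T-≡ p~z)

  endpoints-resp-↭ : ∀ {M M′} → M ↭ M′ → endpoints G M ↭ endpoints G M′
  endpoints-resp-↭ refl = refl
  endpoints-resp-↭ (prep (u , v) p) = ++⁺ˡ (u ∷ v ∷ []) (endpoints-resp-↭ p)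
  endpoints-resp-↭ (swap (u , v) (u′ , v′) p) =
    trans (shifts (u ∷ v ∷ []) (u′ ∷ v′ ∷ []))
          (++⁺ˡ (u′ ∷ v′ ∷ u ∷ v ∷ []) (endpoints-resp-↭ p))
  endpoints-resp-↭ (trans p q) = trans (endpoints-resp-↭ p) (endpoints-resp-↭ q)

  IsMatching-resp-↭ : ∀ {M M′} → M ↭ M′ → IsMatching G M → IsMatching G M′
  IsMatching-resp-↭ p (edges , distinct) =
    All-resp-↭ p edges , Unique-resp-↭ (endpoints-resp-↭ p) distinct

  matching-edge-to-front : ∀ {M u v} → IsMatching G M → (u , v) ∈ M →
    ∃ λ R → IsMatching G ((u , v) ∷ R) × length M ≡ suc (length R)
  matching-edge-to-front {u = u} {v} matching uv∈M with ∈-∃++ uv∈M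
  ... | ys , zs , refl =
    ys ++ zs , IsMatching-resp-↭ front matching , ↭-length front
    where
    front : ys ++ [ (u , v) ] ++ zs ↭ (u , v) ∷ ys ++ zs
    front = shift (u , v) ys zs

  partner-in-matching : ∀ {M x} → AllEdges M → x ∈ endpoints G M →
    ∃ λ w → E G x w × w ∈ endpoints G M
  partner-in-matching (u~v ∷ _) (here refl) = _ , u~v , there (here refl)
  partner-in-matching (u~v ∷ _) (there (here refl)) = _ , E-sym u~v , here refl
  partner-in-matching (_ ∷ edges) (there (there x∈M)) with partner-in-matching edges x∈M
  ... | w , x~w , w∈M = w , x~w , there (there w∈M)

  pendant-uncovered : ∀ {M p q} → AllEdges M → Pendant G p → E G p q →
    q ∉ endpoints G M → p ∉ q ∷ endpoints G M
  pendant-uncovered {M} {p} edges p-pendant p~q q∉M = ∉-∷ (E-irrefl p~q) p∉M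
    where
    p∉M : p ∉ endpoints G M
    p∉M p∈M with partner-in-matching edges p∈M
    ... | w , p~w , w∈M
      rewrite neighbour-of-pendant-unique p-pendant p~w p~q = q∉M w∈M

  replace-by-pendant-edges : ∀ {R u v a b} → IsMatching G ((u , v) ∷ R) →
    ¬ Pendant G u → E G u a → Pendant G a → E G v b → Pendant G b →
    IsMatching G ((a , u) ∷ (b , v) ∷ R)
  replace-by-pendant-edges {R} {u} {v} {a} {b} (_ ∷ edges , uvR!@(_ ∷ vR!))
                                               u-nonpendant u~a a-pendant v~b b-pendant =
    E-sym u~a ∷ E-sym v~b ∷ edges , Unique-∷ a∉ubvR (Unique-∷ u∉bvR (Unique-∷ b∉vR vR!))
    where
    b∉vR : b ∉ v ∷ endpoints G R
    b∉vR = pendant-uncovered edges b-pendant (E-sym v~b) (Unique[x∷xs]⇒x∉xs vR!)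
    u≢b : u ≢ b
    u≢b refl = u-nonpendant b-pendant
    u∉bvR : u ∉ b ∷ v ∷ endpoints G R
    u∉bvR = ∉-∷ u≢b (Unique[x∷xs]⇒x∉xs uvR!)
    a∉ubvR : a ∉ u ∷ b ∷ v ∷ endpoints G R
    a∉ubvR = pendant-uncovered (E-sym v~b ∷ edges) a-pendant (E-sym u~a) u∉bvR

  PendantNeighbours : Set
  PendantNeighbours = ∀ v → ¬ Pendant G v → ∃ λ u → E G v u × Pendant G u

  nonPendant-edge-∉-maximum-matching : PendantNeighbours → ∀ {M u v} →
    IsMaximumMatching G M → NonPendantEdge G u v → (u , v) ∉ M
  nonPendant-edge-∉-maximum-matching pendant-neighbour {u = u} {v} (matching , maximum)
                                     (_ , u-nonpendant , v-nonpendant) uv∈M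
    with matching-edge-to-front matching uv∈M
       | pendant-neighbour _ u-nonpendant | pendant-neighbour _ v-nonpendant
  ... | R , uvR-matching , |M|≡1+|R| | a , u~a , a-pendant | b , v~b , b-pendant =
    1+n≰n (subst (_ ≤_) |M|≡1+|R| (maximum _ augmented))
    where
    augmented : IsMatching G ((a , u) ∷ (b , v) ∷ R)
    augmented = replace-by-pendant-edges uvR-matching u-nonpendant u~a a-pendant v~b b-pendant

theorem3p3 : (n : ℕ) (G : SimpleGraph n) → InClassT G →
    (M : List (Fin n × Fin n)) → IsMaximumMatching G M →
    (u v : Fin n) → NonPendantEdge G u v → ¬ InMatching G u v M
theorem3p3 n G (_ , _ , pendant-neighbour) M maximum u v uv-nonpendant (inj₁ uv∈M) =
  nonPendant-edge-∉-maximum-matching G pendant-neighbour maximum uv-nonpendant uv∈M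
theorem3p3 n G (_ , _ , pendant-neighbour) M maximum u v (u~v , u-np , v-np) (inj₂ vu∈M) =
  nonPendant-edge-∉-maximum-matching G pendant-neighbour maximum (E-sym G u~v , v-np , u-np) vu∈M
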